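{- Let $q$ be a power of $2$ with $q>2$, and let $a\in\mathbb F_q^*$. Then there exists $\eta\in\mathbb F_{q^2}$ such that $\eta+\eta^q=1$ and $\mathrm{Tr}_{q/2}\!\left(\frac{a^2}{\eta+\eta^2}\right)=1$.
   Context: $\mathrm{Tr}_{q/2}(x)=x+x^2+\cdots+x^{q/2}$ is the absolute trace from $\mathbb F_q$ to $\mathbb F_2$. (For $\eta$ with $\eta+\eta^q=1$, one has $\eta+\eta^2=\eta^{q+1}\in\mathbb F_q^*$.) -}

module Defs where

open import Level using (_⊔_)
open import Algebra.Bundles using (CommutativeRing; Semiring)
open import Data.Nat as ℕ using (ℕ; zero; suc)
open import Data.Fin using (Fin)
open import Function.Bundles using (Inverse)
open import Relation.Binary.PropositionalEquality using () renaming (setoid to ≡-setoid)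
open import Relation.Nullary using (¬_)
open import Data.Product using (∃)

module _ {c ℓ} (R : CommutativeRing c ℓ) where
  open CommutativeRing R
  open import Algebra.Definitions.RawSemiring (Semiring.rawSemiring semiring) using (_^_) public

  record IsField : Set (c ⊔ ℓ) where
    field
      1≉0     : ¬ (1# ≈ 0#)
      inverse : ∀ x → ¬ (x ≈ 0#) → ∃ λ y → y * x ≈ 1#

  HasCardinality : ℕ → Set (c ⊔ ℓ)
  HasCardinality n = Inverse (≡-setoid (Fin n)) (CommutativeRing.setoid R)

  -- Absolute trace from F_q to F_2 with q = 2^m:
  --   trace m x = x + x^2 + x^4 + ... + x^(2^(m-1))   (= x + ... + x^(q/2))
  trace : ℕ → Carrier → Carrier
  trace zero    x = 0#
  trace (suc m) x = x ^ (2 ℕ.^ m) + trace m x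

-- Everything rests on one counting fact: a polynomial function of degree d < |K| with nonzero
-- leading coefficient has a nonroot. Since |K| = q² is even, Fermat's little theorem applied
-- to −1 gives characteristic 2, and x ↦ x^q is an involution of K. As x^q + x has degree
-- q < q², some ξ has ξ + ξ^q ≠ 0, and η₀ = ξ / (ξ + ξ^q) solves η + η^q = 1; hence so does
-- η(x) = η₀ + x + x^q for every x, a monic polynomial of degree q in x. Then u(x) = η + η² is
-- a nonzero element of 𝔽_q. If Tr_{q/2}(a²/u(x)) vanished for every x, so would
-- u(x)^{q/2} · Tr_{q/2}(a²/u(x)), a polynomial in x of degree (q/2 − 1)·2q < q² with leading
-- coefficient a² ≠ 0, which is impossible. Finally the trace is idempotent on 𝔽_q, so a
-- nonzero value of it is 1.

module Submission where

open import Algebra.Bundles using (CommutativeRing; Semiring)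
open import Data.Empty using (⊥-elim)
open import Data.Fin using (Fin; zero; suc; punchIn; punchOut)
import Data.Fin.Properties as Fin
open import Data.Nat as ℕ using (ℕ; zero; suc; _≤_; _<_; z≤n; s≤s)
import Data.Nat.Properties as ℕ
open import Data.Nat.Tactic.RingSolver using (solve-∀)
open import Data.Product using (∃; _×_; _,_; proj₁; proj₂)
open import Defs using (IsField; HasCardinality; trace)
open import Function.Bundles using (Inverse)
open import Function.Definitions using (Injective)
open import Level using (_⊔_)
open import Relation.Binary.PropositionalEquality as ≡ using (_≡_)
open import Relation.Nullary using (¬_; Dec; yes; no)

mersenne : ℕ → ℕ
mersenne zero    = 0
mersenne (suc i) = suc (2 ℕ.* mersenne i)

suc-mersenne : ∀ i → suc (mersenne i) ≡ 2 ℕ.^ i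
suc-mersenne zero    = ≡.refl
suc-mersenne (suc i) = ≡.trans (≡.sym (ℕ.*-suc 2 (mersenne i))) (≡.cong (2 ℕ.*_) (suc-mersenne i))

1<2^[1+j] : ∀ j → 1 < 2 ℕ.^ suc j
1<2^[1+j] j = ℕ.^-monoʳ-< 2 (ℕ.n<1+n 1) {0} {suc j} (s≤s z≤n)

2^[1+j]<[2^[1+j]]² : ∀ j → 2 ℕ.^ suc j < (2 ℕ.^ suc j) ℕ.^ 2
2^[1+j]<[2^[1+j]]² j = ≡.subst (q <_) (≡.cong (q ℕ.*_) (≡.sym (ℕ.*-identityʳ q)))
  (ℕ.m<m*n q q {{ℕ.m^n≢0 2 (suc j)}} (1<2^[1+j] j))
  where
  q : ℕ
  q = 2 ℕ.^ suc j

mersenne*2^[2+j]<[2^[1+j]]² : ∀ j → mersenne j ℕ.* 2 ℕ.^ suc (suc j) < (2 ℕ.^ suc j) ℕ.^ 2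
mersenne*2^[2+j]<[2^[1+j]]² j = begin-strict
  mersenne j ℕ.* 2 ℕ.^ suc (suc j)         <⟨ ℕ.m<n+m _ (ℕ.m^n>0 2 (suc (suc j))) ⟩
  suc (mersenne j) ℕ.* 2 ℕ.^ suc (suc j)   ≡⟨ ≡.cong (ℕ._* 2 ℕ.^ suc (suc j)) (suc-mersenne j) ⟩
  2 ℕ.^ j ℕ.* 2 ℕ.^ suc (suc j)            ≡⟨ regroup (2 ℕ.^ j) ⟩
  (2 ℕ.^ suc j) ℕ.^ 2                      ∎
  where
  open ℕ.≤-Reasoning
  regroup : ∀ t → t ℕ.* (2 ℕ.* (2 ℕ.* t)) ≡ (2 ℕ.* t) ℕ.* ((2 ℕ.* t) ℕ.* 1)
  regroup = solve-∀

module _ {c ℓ} (K : CommutativeRing c ℓ) where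
  open CommutativeRing K hiding (zero)
  open import Algebra.Definitions.RawSemiring (Semiring.rawSemiring semiring) using (_^_)
  open import Algebra.Properties.Semiring.Exp semiring using (^-congˡ; ^-congʳ; ^-assocʳ)
  open import Algebra.Properties.CommutativeSemiring.Exp commutativeSemiring using (^-distrib-*)
  open import Algebra.Solver.Ring.NaturalCoefficients.Default commutativeSemiring
    using (solve; _:=_; _:+_; _:*_; _:^_; con)
  open import Relation.Binary.Reasoning.Setoid setoid

  -- f agrees pointwise with a polynomial, in Horner form, of formal degree d whose coefficient
  -- of x^d is l. Nothing forces l ≉ 0#, so d is only an upper bound on the true degree.
  data IsPolynomial : ℕ → Carrier → (Carrier → Carrier) → Set (c ⊔ ℓ) where
    constant : ∀ {l f} → (∀ x → f x ≈ l) → IsPolynomial 0 l f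
    horner   : ∀ {d l f g} k → IsPolynomial d l g → (∀ x → f x ≈ k + x * g x) →
               IsPolynomial (suc d) l f

  IsPolynomial-resp : ∀ {d l f g} → (∀ x → g x ≈ f x) → IsPolynomial d l f → IsPolynomial d l g
  IsPolynomial-resp g≈f (constant f≈l)     = constant (λ x → trans (g≈f x) (f≈l x))
  IsPolynomial-resp g≈f (horner k p f≈kxg) = horner k p (λ x → trans (g≈f x) (f≈kxg x))

  leading-cong : ∀ {d l l′ f} → l ≈ l′ → IsPolynomial d l f → IsPolynomial d l′ f
  leading-cong l≈l′ (constant f≈l)     = constant (λ x → trans (f≈l x) l≈l′)
  leading-cong l≈l′ (horner k p f≈kxg) = horner k (leading-cong l≈l′ p) f≈kxg

  id-polynomial : IsPolynomial 1 1# (λ x → x)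
  id-polynomial = horner 0# (constant (λ _ → refl))
    (λ x → sym (trans (+-identityˡ _) (*-identityʳ x)))

  xⁿ-polynomial : ∀ n → IsPolynomial n 1# (_^ n)
  xⁿ-polynomial zero    = constant (λ _ → refl)
  xⁿ-polynomial (suc n) = horner 0# (xⁿ-polynomial n) (λ x → sym (+-identityˡ _))

  *-polynomialˡ : ∀ {d l f} a → IsPolynomial d l f → IsPolynomial d (a * l) (λ x → a * f x)
  *-polynomialˡ a (constant f≈l)     = constant (λ x → *-congˡ (f≈l x))
  *-polynomialˡ a (horner k p f≈kxg) = horner (a * k) (*-polynomialˡ a p)
    (λ x → trans (*-congˡ (f≈kxg x)) (distribute a k x _))
    where
    distribute : ∀ a k x y → a * (k + x * y) ≈ a * k + x * (a * y)
    distribute = solve 4 (λ a k x y → a :* (k :+ x :* y) := a :* k :+ x :* (a :* y)) refl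

  +-polynomial-dominant : ∀ {d e l l′ f g} → e < d → IsPolynomial d l f → IsPolynomial e l′ g →
                          IsPolynomial d l (λ x → f x + g x)
  +-polynomial-dominant {l′ = l′} _ (horner k p f≈kxh) (constant g≈l′) =
    horner (k + l′) p (λ x → trans (+-cong (f≈kxh x) (g≈l′ x)) (swap k _ l′))
    where
    swap : ∀ k y l′ → (k + y) + l′ ≈ (k + l′) + y
    swap = solve 3 (λ k y l′ → (k :+ y) :+ l′ := (k :+ l′) :+ y) refl
  +-polynomial-dominant (s≤s e<d) (horner k p f≈kxh) (horner k′ p′ g≈k′xh′) =
    horner (k + k′) (+-polynomial-dominant e<d p p′)
      (λ x → trans (+-cong (f≈kxh x) (g≈k′xh′ x)) (collect k k′ x _ _))
    where
    collect : ∀ k k′ x y y′ → (k + x * y) + (k′ + x * y′) ≈ (k + k′) + x * (y + y′)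
    collect = solve 5 (λ k k′ x y y′ →
      (k :+ x :* y) :+ (k′ :+ x :* y′) := (k :+ k′) :+ x :* (y :+ y′)) refl

  *-polynomial : ∀ {d e l l′ f g} → IsPolynomial d l f → IsPolynomial e l′ g →
                 IsPolynomial (d ℕ.+ e) (l * l′) (λ x → f x * g x)
  *-polynomial (constant f≈l) q = IsPolynomial-resp (λ x → *-congʳ (f≈l x)) (*-polynomialˡ _ q)
  *-polynomial {suc d} {e} (horner k p f≈kxh) q =
    IsPolynomial-resp (λ x → trans (*-congʳ (f≈kxh x)) (expand k x _ _))
      (+-polynomial-dominant (s≤s (ℕ.m≤n+m e d))
        (horner 0# (*-polynomial p q) (λ _ → refl)) (*-polynomialˡ k q))
    where
    expand : ∀ k x y z → (k + x * y) * z ≈ (0# + x * (y * z)) + k * z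
    expand = solve 4 (λ k x y z → (k :+ x :* y) :* z := (con 0 :+ x :* (y :* z)) :+ k :* z) refl

  ^-polynomial : ∀ {e l f} n → IsPolynomial e l f → IsPolynomial (n ℕ.* e) (l ^ n) (λ x → f x ^ n)
  ^-polynomial zero    p = constant (λ _ → refl)
  ^-polynomial (suc n) p = *-polynomial p (^-polynomial n p)

  -- The factor theorem f x − f r = (x − r) · g x, with the subtractions moved to the other
  -- side so that it holds in any commutative semiring.
  factor : ∀ {d l f} → IsPolynomial (suc d) l f → ∀ r →
           ∃ λ g → IsPolynomial d l g × (∀ x → f x + r * g x ≈ f r + x * g x)
  factor {l = l} {f} (horner k (constant h≈l) f≈kxh) r =
    (λ _ → l) , constant (λ _ → refl) , λ x → begin
      f x + r * l          ≈⟨ +-congʳ (f≈kxl x) ⟩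
      (k + x * l) + r * l  ≈⟨ swap k x r l ⟩
      (k + r * l) + x * l  ≈⟨ +-congʳ (f≈kxl r) ⟨
      f r + x * l          ∎
    where
    f≈kxl : ∀ x → f x ≈ k + x * l
    f≈kxl x = trans (f≈kxh x) (+-congˡ (*-congˡ (h≈l x)))
    swap : ∀ k x r l → (k + x * l) + r * l ≈ (k + r * l) + x * l
    swap = solve 4 (λ k x r l → (k :+ x :* l) :+ r :* l := (k :+ r :* l) :+ x :* l) refl
  factor {f = f} (horner {g = h} k p@(horner _ _ _) f≈kxh) r with factor p r
  ... | g , q , h-split = (λ x → h r + x * g x) , horner (h r) q (λ _ → refl) , λ x → begin
      f x + r * (h r + x * g x)            ≈⟨ +-congʳ (f≈kxh x) ⟩
      (k + x * h x) + r * (h r + x * g x)  ≈⟨ regroup k x (h x) r (h r) (g x) ⟩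
      (k + r * h r) + x * (h x + r * g x)  ≈⟨ +-congˡ (*-congˡ (h-split x)) ⟩
      (k + r * h r) + x * (h r + x * g x)  ≈⟨ +-congʳ (f≈kxh r) ⟨
      f r + x * (h r + x * g x)            ∎
    where
    regroup : ∀ k x y r y₀ z → (k + x * y) + r * (y₀ + x * z) ≈ (k + r * y₀) + x * (y + r * z)
    regroup = solve 6 (λ k x y r y₀ z →
      (k :+ x :* y) :+ r :* (y₀ :+ x :* z) := (k :+ r :* y₀) :+ x :* (y :+ r :* z)) refl

  1#^n≈1# : ∀ n → 1# ^ n ≈ 1#
  1#^n≈1# zero    = refl
  1#^n≈1# (suc n) = trans (*-identityˡ _) (1#^n≈1# n)

  ^-2^-suc : ∀ x k → x ^ (2 ℕ.^ suc k) ≈ (x ^ (2 ℕ.^ k)) ^ 2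
  ^-2^-suc x k = trans (^-congʳ x (ℕ.*-comm 2 (2 ℕ.^ k))) (sym (^-assocʳ x (2 ℕ.^ k) 2))

  ^-comm-exponents : ∀ x m n → (x ^ m) ^ n ≈ (x ^ n) ^ m
  ^-comm-exponents x m n =
    trans (^-assocʳ x m n) (trans (^-congʳ x (ℕ.*-comm m n)) (sym (^-assocʳ x n m)))

  ^-fixed-^ : ∀ {x n} m → x ^ n ≈ x → (x ^ m) ^ n ≈ x ^ m
  ^-fixed-^ {x} {n} m xⁿ≈x = trans (^-comm-exponents x m n) (^-congˡ m xⁿ≈x)

  idempotent⇒^2^≈id : ∀ {x} → x ^ 2 ≈ x → ∀ k → x ^ (2 ℕ.^ k) ≈ x
  idempotent⇒^2^≈id x²≈x zero    = *-identityʳ _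
  idempotent⇒^2^≈id {x} x²≈x (suc k) =
    trans (^-2^-suc x k) (trans (^-congˡ 2 (idempotent⇒^2^≈id x²≈x k)) x²≈x)

  trace-1 : ∀ z → trace K 1 z ≈ z
  trace-1 z = trans (+-identityʳ _) (*-identityʳ z)

  module CharacteristicTwo (1+1≈0 : 1# + 1# ≈ 0#) where
    open import Algebra.Properties.Group +-group using (∙-cancelʳ)

    x+x≈0 : ∀ x → x + x ≈ 0#
    x+x≈0 x = begin
      x + x              ≈⟨ +-cong (*-identityˡ x) (*-identityˡ x) ⟨
      1# * x + 1# * x    ≈⟨ distribʳ x 1# 1# ⟨
      (1# + 1#) * x      ≈⟨ *-congʳ 1+1≈0 ⟩
      0# * x             ≈⟨ zeroˡ x ⟩
      0#                 ∎

    ^2-distrib-+ : ∀ x y → (x + y) ^ 2 ≈ x ^ 2 + y ^ 2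
    ^2-distrib-+ x y = begin
      (x + y) ^ 2                                ≈⟨ expand x y ⟩
      (x ^ 2 + y ^ 2) + (x * y + x * y)          ≈⟨ +-congˡ (x+x≈0 (x * y)) ⟩
      (x ^ 2 + y ^ 2) + 0#                       ≈⟨ +-identityʳ _ ⟩
      x ^ 2 + y ^ 2                              ∎
      where
      expand : ∀ x y → (x + y) ^ 2 ≈ (x ^ 2 + y ^ 2) + (x * y + x * y)
      expand = solve 2 (λ x y → (x :+ y) :^ 2 := (x :^ 2 :+ y :^ 2) :+ (x :* y :+ x :* y)) refl

    ^2^-distrib-+ : ∀ k x y → (x + y) ^ (2 ℕ.^ k) ≈ x ^ (2 ℕ.^ k) + y ^ (2 ℕ.^ k)
    ^2^-distrib-+ zero    x y = trans (*-identityʳ _) (sym (+-cong (*-identityʳ x) (*-identityʳ y)))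
    ^2^-distrib-+ (suc k) x y = begin
      (x + y) ^ (2 ℕ.^ suc k)                      ≈⟨ ^-2^-suc (x + y) k ⟩
      ((x + y) ^ (2 ℕ.^ k)) ^ 2                    ≈⟨ ^-congˡ 2 (^2^-distrib-+ k x y) ⟩
      (x ^ (2 ℕ.^ k) + y ^ (2 ℕ.^ k)) ^ 2          ≈⟨ ^2-distrib-+ _ _ ⟩
      (x ^ (2 ℕ.^ k)) ^ 2 + (y ^ (2 ℕ.^ k)) ^ 2    ≈⟨ +-cong (^-2^-suc x k) (^-2^-suc y k) ⟨
      x ^ (2 ℕ.^ suc k) + y ^ (2 ℕ.^ suc k)        ∎

    x+y≈z⇒y≈x+z : ∀ {x y z} → x + y ≈ z → y ≈ x + z
    x+y≈z⇒y≈x+z {x} {y} {z} x+y≈z = begin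
      y              ≈⟨ +-identityˡ y ⟨
      0# + y         ≈⟨ +-congʳ (x+x≈0 x) ⟨
      (x + x) + y    ≈⟨ +-assoc x x y ⟩
      x + (x + y)    ≈⟨ +-congˡ x+y≈z ⟩
      x + z          ∎

    ℘ : Carrier → Carrier
    ℘ x = x + x ^ 2

    ℘-cong : ∀ {x y} → x ≈ y → ℘ x ≈ ℘ y
    ℘-cong x≈y = +-cong x≈y (^-congˡ 2 x≈y)

    ℘-+1 : ∀ x → ℘ (x + 1#) ≈ ℘ x
    ℘-+1 x = begin
      (x + 1#) + (x + 1#) ^ 2        ≈⟨ +-congˡ (^2-distrib-+ x 1#) ⟩
      (x + 1#) + (x ^ 2 + 1# ^ 2)    ≈⟨ regroup x 1# (x ^ 2) (1# ^ 2) ⟩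
      (1# + 1# ^ 2) + ℘ x            ≈⟨ +-congʳ (trans (+-congˡ (1#^n≈1# 2)) 1+1≈0) ⟩
      0# + ℘ x                       ≈⟨ +-identityˡ _ ⟩
      ℘ x                            ∎
      where
      regroup : ∀ a b c d → (a + b) + (c + d) ≈ (b + d) + (a + c)
      regroup = solve 4 (λ a b c d → (a :+ b) :+ (c :+ d) := (b :+ d) :+ (a :+ c)) refl

    ℘-^2^ : ∀ k x → ℘ x ^ (2 ℕ.^ k) ≈ ℘ (x ^ (2 ℕ.^ k))
    ℘-^2^ k x = trans (^2^-distrib-+ k x (x ^ 2)) (+-congˡ (^-comm-exponents x 2 (2 ℕ.^ k)))

    ℘≈0⇒idempotent : ∀ {x} → ℘ x ≈ 0# → x ^ 2 ≈ x
    ℘≈0⇒idempotent ℘x≈0 = trans (x+y≈z⇒y≈x+z ℘x≈0) (+-identityʳ _)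

    trace-suc : ∀ m z → trace K (suc m) z ≈ trace K m z ^ 2 + z
    trace-suc zero    z = begin
      trace K 1 z          ≈⟨ trace-1 z ⟩
      z                    ≈⟨ +-identityˡ z ⟨
      0# + z               ≈⟨ +-congʳ (zeroˡ _) ⟨
      0# ^ 2 + z           ∎
    trace-suc (suc m) z = begin
      z ^ (2 ℕ.^ suc m) + trace K (suc m) z              ≈⟨ +-congˡ (trace-suc m z) ⟩
      z ^ (2 ℕ.^ suc m) + (trace K m z ^ 2 + z)          ≈⟨ +-assoc _ _ _ ⟨
      (z ^ (2 ℕ.^ suc m) + trace K m z ^ 2) + z          ≈⟨ +-congʳ (+-congʳ (^-2^-suc z m)) ⟩
      ((z ^ (2 ℕ.^ m)) ^ 2 + trace K m z ^ 2) + z        ≈⟨ +-congʳ (^2-distrib-+ _ _) ⟨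
      trace K (suc m) z ^ 2 + z                          ∎

    trace-idempotent : ∀ m z → z ^ (2 ℕ.^ m) ≈ z → trace K m z ^ 2 ≈ trace K m z
    trace-idempotent m z z-fixed = ∙-cancelʳ z _ _ (begin
      trace K m z ^ 2 + z            ≈⟨ trace-suc m z ⟨
      z ^ (2 ℕ.^ m) + trace K m z    ≈⟨ +-congʳ z-fixed ⟩
      z + trace K m z                ≈⟨ +-comm _ _ ⟩
      trace K m z + z                ∎)

    -- u^(2^i) · trace (i + 1) (c / u), written without the inverse of u.
    clearedTrace : Carrier → Carrier → ℕ → Carrier
    clearedTrace c u zero    = c
    clearedTrace c u (suc i) = c * u ^ mersenne (suc i) + clearedTrace c u i ^ 2

    clearedTrace-spec : ∀ {u w} c → w * u ≈ 1# → ∀ i →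
                        u ^ (2 ℕ.^ i) * trace K (suc i) (c * w) ≈ clearedTrace c u i
    clearedTrace-spec {u} {w} c wu≈1 zero = begin
      u ^ 1 * trace K 1 (c * w)  ≈⟨ *-cong (*-identityʳ u) (trace-1 (c * w)) ⟩
      u * (c * w)                ≈⟨ rearrange u c w ⟩
      c * (w * u)                ≈⟨ *-congˡ wu≈1 ⟩
      c * 1#                     ≈⟨ *-identityʳ c ⟩
      c                          ∎
      where
      rearrange : ∀ u c w → u * (c * w) ≈ c * (w * u)
      rearrange = solve 3 (λ u c w → u :* (c :* w) := c :* (w :* u)) refl
    clearedTrace-spec {u} {w} c wu≈1 (suc i) = begin
      u ^ (2 ℕ.^ suc i) * trace K (suc (suc i)) (c * w)  ≈⟨ *-cong (^-2^-suc u i) trace-step ⟩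
      v ^ 2 * (T ^ 2 + c * w)                            ≈⟨ distribˡ (v ^ 2) (T ^ 2) (c * w) ⟩
      v ^ 2 * T ^ 2 + v ^ 2 * (c * w)                    ≈⟨ +-congˡ v²cw≈cuᴹ ⟩
      v ^ 2 * T ^ 2 + c * u ^ M                          ≈⟨ +-congʳ (^-distrib-* v T 2) ⟨
      (v * T) ^ 2 + c * u ^ M                            ≈⟨ +-congʳ (^-congˡ 2 vT≈cleared) ⟩
      clearedTrace c u i ^ 2 + c * u ^ M                 ≈⟨ +-comm _ _ ⟩
      clearedTrace c u (suc i)                           ∎
      where
      v T : Carrier
      v = u ^ (2 ℕ.^ i)
      T = trace K (suc i) (c * w)
      M : ℕ
      M = mersenne (suc i)
      trace-step : trace K (suc (suc i)) (c * w) ≈ T ^ 2 + c * w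
      trace-step = trace-suc (suc i) (c * w)
      vT≈cleared : v * T ≈ clearedTrace c u i
      vT≈cleared = clearedTrace-spec c wu≈1 i
      rearrange : ∀ u c w x → (u * x) * (c * w) ≈ (c * x) * (w * u)
      rearrange = solve 4 (λ u c w x → (u :* x) :* (c :* w) := (c :* x) :* (w :* u)) refl
      v²cw≈cuᴹ : v ^ 2 * (c * w) ≈ c * u ^ M
      v²cw≈cuᴹ = begin
        v ^ 2 * (c * w)              ≈⟨ *-congʳ (^-2^-suc u i) ⟨
        u ^ (2 ℕ.^ suc i) * (c * w)  ≈⟨ *-congʳ (^-congʳ u (suc-mersenne (suc i))) ⟨
        (u * u ^ M) * (c * w)        ≈⟨ rearrange u c w (u ^ M) ⟩
        (c * u ^ M) * (w * u)        ≈⟨ *-congˡ wu≈1 ⟩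
        (c * u ^ M) * 1#             ≈⟨ *-identityʳ _ ⟩
        c * u ^ M                    ∎

    clearedTrace-polynomial : ∀ {D u} c → 0 < D → IsPolynomial D 1# u → ∀ i →
                              IsPolynomial (mersenne i ℕ.* D) c (λ x → clearedTrace c (u x) i)
    clearedTrace-polynomial c D>0 p zero    = constant (λ _ → refl)
    clearedTrace-polynomial {D} c D>0 p (suc i) = +-polynomial-dominant lower-degree
      (leading-cong c*1ᴹ≈c (*-polynomialˡ c (^-polynomial M p)))
      (^-polynomial 2 (clearedTrace-polynomial c D>0 p i))
      where
      M : ℕ
      M = mersenne (suc i)
      c*1ᴹ≈c : c * 1# ^ M ≈ c
      c*1ᴹ≈c = trans (*-congˡ (1#^n≈1# M)) (*-identityʳ c)
      lower-degree : 2 ℕ.* (mersenne i ℕ.* D) < mersenne (suc i) ℕ.* D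
      lower-degree = ≡.subst (_< D ℕ.+ 2 ℕ.* mersenne i ℕ.* D) (ℕ.*-assoc 2 (mersenne i) D)
        (ℕ.m<n+m _ D>0)

  module _ (isField : IsField K) where
    open IsField isField
    open import Algebra.Properties.Ring ring using (-‿distribˡ-*)
    open import Algebra.Properties.Group +-group using (x∙y⁻¹≈ε⇒x≈y)

    *-cancelʳ-≉0 : ∀ {p x y} → p ≉ 0# → x * p ≈ y * p → x ≈ y
    *-cancelʳ-≉0 {p} {x} {y} p≉0 xp≈yp with inverse p p≉0
    ... | p⁻¹ , p⁻¹p≈1 = begin
      x              ≈⟨ undo x ⟨
      (x * p) * p⁻¹  ≈⟨ *-congʳ xp≈yp ⟩
      (y * p) * p⁻¹  ≈⟨ undo y ⟩
      y              ∎
      where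
      undo : ∀ z → (z * p) * p⁻¹ ≈ z
      undo z = trans (*-assoc z p p⁻¹)
        (trans (*-congˡ (trans (*-comm p p⁻¹) p⁻¹p≈1)) (*-identityʳ z))

    x*y≈0⇒y≈0 : ∀ {x y} → x ≉ 0# → x * y ≈ 0# → y ≈ 0#
    x*y≈0⇒y≈0 {x} {y} x≉0 xy≈0 =
      *-cancelʳ-≉0 x≉0 (trans (*-comm y x) (trans xy≈0 (sym (zeroˡ x))))

    *-≉0 : ∀ {x y} → x ≉ 0# → y ≉ 0# → x * y ≉ 0#
    *-≉0 x≉0 y≉0 xy≈0 = y≉0 (x*y≈0⇒y≈0 x≉0 xy≈0)

    x*y≈1⇒y≉0 : ∀ {x y} → x * y ≈ 1# → y ≉ 0#
    x*y≈1⇒y≉0 {x} xy≈1 y≈0 = 1≉0 (trans (sym xy≈1) (trans (*-congˡ y≈0) (zeroʳ x)))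

    ^-≉0 : ∀ {x} n → x ≉ 0# → x ^ n ≉ 0#
    ^-≉0 zero    x≉0 = 1≉0
    ^-≉0 (suc n) x≉0 = *-≉0 x≉0 (^-≉0 n x≉0)

    x*z≈y*z⇒z≈0 : ∀ {x y z} → x * z ≈ y * z → x ≉ y → z ≈ 0#
    x*z≈y*z⇒z≈0 {x} {y} {z} xz≈yz x≉y = x*y≈0⇒y≈0 x-y≉0 (begin
      (x - y) * z        ≈⟨ distribʳ z x (- y) ⟩
      x * z + - y * z    ≈⟨ +-cong xz≈yz (sym (-‿distribˡ-* y z)) ⟩
      y * z - y * z      ≈⟨ -‿inverseʳ (y * z) ⟩
      0#                 ∎)
      where
      x-y≉0 : x - y ≉ 0#
      x-y≉0 x-y≈0 = x≉y (x∙y⁻¹≈ε⇒x≈y x y x-y≈0)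

    idempotent-≉0⇒≈1 : ∀ {x} → x ^ 2 ≈ x → x ≉ 0# → x ≈ 1#
    idempotent-≉0⇒≈1 {x} x²≈x x≉0 = *-cancelʳ-≉0 x≉0 (begin
      x * x     ≈⟨ *-congˡ (*-identityʳ x) ⟨
      x ^ 2     ≈⟨ x²≈x ⟩
      x         ≈⟨ *-identityˡ x ⟨
      1# * x    ∎)

    ^-fixed-inverse : ∀ {u w} n → w * u ≈ 1# → u ^ n ≈ u → w ^ n ≈ w
    ^-fixed-inverse {u} {w} n wu≈1 uⁿ≈u = *-cancelʳ-≉0 (x*y≈1⇒y≉0 wu≈1) (begin
      w ^ n * u      ≈⟨ *-congˡ uⁿ≈u ⟨
      w ^ n * u ^ n  ≈⟨ ^-distrib-* w u n ⟨
      (w * u) ^ n    ≈⟨ ^-congˡ n wu≈1 ⟩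
      1# ^ n         ≈⟨ 1#^n≈1# n ⟩
      1#             ≈⟨ wu≈1 ⟨
      w * u          ∎)

    roots≤degree : ∀ {d l f n} → IsPolynomial d l f → l ≉ 0# → (v : Fin n → Carrier) →
                   Injective _≡_ _≈_ v → (∀ i → f (v i) ≈ 0#) → n ≤ d
    roots≤degree {n = zero} _ _ _ _ _ = z≤n
    roots≤degree {n = suc n} (constant f≈l) l≉0 v _ roots =
      ⊥-elim (l≉0 (trans (sym (f≈l (v zero))) (roots zero)))
    roots≤degree {f = f} {n = suc n} p@(horner _ _ _) l≉0 v v-inj roots with factor p (v zero)
    ... | g , q , f-split =
      s≤s (roots≤degree q l≉0 (λ i → v (suc i)) (λ eq → Fin.suc-injective (v-inj eq)) g-roots)
      where
      g-roots : ∀ i → g (v (suc i)) ≈ 0#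
      g-roots i = x*z≈y*z⇒z≈0 (begin
        v zero * g vᵢ          ≈⟨ +-identityˡ _ ⟨
        0# + v zero * g vᵢ     ≈⟨ +-congʳ (roots (suc i)) ⟨
        f vᵢ + v zero * g vᵢ   ≈⟨ f-split vᵢ ⟩
        f (v zero) + vᵢ * g vᵢ ≈⟨ +-congʳ (roots zero) ⟩
        0# + vᵢ * g vᵢ         ≈⟨ +-identityˡ _ ⟩
        vᵢ * g vᵢ              ∎)
        (λ v₀≈vᵢ → Fin.0≢1+n (v-inj v₀≈vᵢ))
        where
        vᵢ : Carrier
        vᵢ = v (suc i)

    module _ {N} (card : HasCardinality K N) where
      open Inverse card using (to; from; from-cong; strictlyInverseˡ; strictlyInverseʳ)

      to-injective : Injective _≡_ _≈_ to
      to-injective {i} {j} toi≈toj =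
        ≡.trans (≡.sym (strictlyInverseʳ i)) (≡.trans (from-cong toi≈toj) (strictlyInverseʳ j))

      from-injective : Injective _≈_ _≡_ from
      from-injective {x} {y} fromx≡fromy = begin
        x            ≈⟨ strictlyInverseˡ x ⟨
        to (from x)  ≡⟨ ≡.cong to fromx≡fromy ⟩
        to (from y)  ≈⟨ strictlyInverseˡ y ⟩
        y            ∎

      _≈?_ : ∀ x y → Dec (x ≈ y)
      x ≈? y with from x Fin.≟ from y
      ... | yes fromx≡fromy = yes (from-injective fromx≡fromy)
      ... | no  fromx≢fromy = no (λ x≈y → fromx≢fromy (from-cong x≈y))

      ∃-nonroot : ∀ {d l f} → IsPolynomial d l f → l ≉ 0# → d < N → ∃ λ x → f x ≉ 0#
      ∃-nonroot {f = f} p l≉0 d<N with Fin.all? (λ i → f (to i) ≈? 0#)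
      ... | yes roots = ⊥-elim (ℕ.<⇒≱ d<N (roots≤degree p l≉0 to to-injective roots))
      ... | no ¬roots with Fin.¬∀⟶∃¬ N _ (λ i → f (to i) ≈? 0#) ¬roots
      ...   | i , f[toi]≉0 = to i , f[toi]≉0

    module _ {n} (card : HasCardinality K (suc n)) where
      open Inverse card using (to; from; from-cong; strictlyInverseˡ; strictlyInverseʳ)
      open import Algebra.Properties.CommutativeMonoid.Sum *-commutativeMonoid
        using (sum-permute; sum-cong-≋; sum-replicate)
        renaming (sum to ∏; ∑-distrib-+ to ∏-distrib-*)
      open import Data.Fin.Permutation using (Permutation; permutation)

      private
        zero-index : Fin (suc n)
        zero-index = from 0#

        nonzero : Fin n → Carrier
        nonzero i = to (punchIn zero-index i)

        nonzero-≉0 : ∀ i → nonzero i ≉ 0#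
        nonzero-≉0 i nonzeroᵢ≈0 = Fin.punchInᵢ≢i zero-index i
          (≡.trans (≡.sym (strictlyInverseʳ _)) (from-cong nonzeroᵢ≈0))

        scale : ∀ x → x ≉ 0# → Fin n → Fin n
        scale x x≉0 i = punchOut {i = zero-index} {j = from (x * nonzero i)}
          (λ eq → *-≉0 x≉0 (nonzero-≉0 i) (sym (from-injective card eq)))

        nonzero-scale : ∀ x x≉0 i → nonzero (scale x x≉0 i) ≈ x * nonzero i
        nonzero-scale x x≉0 i = begin
          to (punchIn zero-index (scale x x≉0 i))  ≡⟨ ≡.cong to (Fin.punchIn-punchOut _) ⟩
          to (from (x * nonzero i))                ≈⟨ strictlyInverseˡ _ ⟩
          x * nonzero i                            ∎

        scale-inverse : ∀ {x y} x≉0 y≉0 → y * x ≈ 1# → ∀ i → scale y y≉0 (scale x x≉0 i) ≡ i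
        scale-inverse {x} {y} x≉0 y≉0 yx≈1 i = Fin.punchIn-injective zero-index _ _
          (≡.trans (Fin.punchIn-punchOut _) (≡.trans (from-cong yxeᵢ≈eᵢ) (strictlyInverseʳ _)))
          where
          yxeᵢ≈eᵢ : y * nonzero (scale x x≉0 i) ≈ nonzero i
          yxeᵢ≈eᵢ = trans (*-congˡ (nonzero-scale x x≉0 i))
            (trans (sym (*-assoc y x _)) (trans (*-congʳ yx≈1) (*-identityˡ _)))

        ∏-≉0 : ∀ {k} (f : Fin k → Carrier) → (∀ i → f i ≉ 0#) → ∏ f ≉ 0#
        ∏-≉0 {zero}  f f≉0 = 1≉0
        ∏-≉0 {suc k} f f≉0 = *-≉0 (f≉0 zero) (∏-≉0 (λ i → f (suc i)) (λ i → f≉0 (suc i)))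

      fermat : ∀ x → x ≉ 0# → x ^ n ≈ 1#
      fermat x x≉0 with inverse x x≉0
      ... | x⁻¹ , x⁻¹x≈1 = *-cancelʳ-≉0 (∏-≉0 nonzero nonzero-≉0) (begin
        x ^ n * ∏ nonzero                    ≈⟨ *-congʳ (sum-replicate n) ⟨
        ∏ {n} (λ _ → x) * ∏ nonzero          ≈⟨ ∏-distrib-* (λ _ → x) nonzero ⟨
        ∏ (λ i → x * nonzero i)              ≈⟨ sum-cong-≋ (nonzero-scale x x≉0) ⟨
        ∏ (λ i → nonzero (scale x x≉0 i))    ≈⟨ sum-permute nonzero π ⟨
        ∏ nonzero                            ≈⟨ *-identityˡ _ ⟨
        1# * ∏ nonzero                       ∎)
        where
        x⁻¹≉0 : x⁻¹ ≉ 0#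
        x⁻¹≉0 = x*y≈1⇒y≉0 (trans (*-comm x x⁻¹) x⁻¹x≈1)
        π : Permutation n n
        π = permutation (scale x x≉0) (scale x⁻¹ x⁻¹≉0)
          (scale-inverse x⁻¹≉0 x≉0 (trans (*-comm x x⁻¹) x⁻¹x≈1)) (scale-inverse x≉0 x⁻¹≉0 x⁻¹x≈1)

    ^-cardinality≈id : ∀ {N} → HasCardinality K N → ∀ x → x ^ N ≈ x
    ^-cardinality≈id {zero}  card x = ⊥-elim (Fin.¬Fin0 (Inverse.from card x))
    ^-cardinality≈id {suc n} card x with _≈?_ card x 0#
    ... | yes x≈0 = trans (*-congʳ x≈0) (trans (zeroˡ _) (sym x≈0))
    ... | no  x≉0 = trans (*-congˡ (fermat card x x≉0)) (*-identityʳ x)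

    characteristic-two : ∀ {n} → HasCardinality K (2 ℕ.* n) → 1# + 1# ≈ 0#
    characteristic-two {zero}  card = ⊥-elim (Fin.¬Fin0 (Inverse.from card 0#))
    characteristic-two {suc k} card = begin
      1# + 1#    ≈⟨ +-congˡ -1≈1 ⟨
      1# - 1#    ≈⟨ -‿inverseʳ 1# ⟩
      0#         ∎
      where
      open import Algebra.Properties.Ring ring using (-1*x≈-x)
      open import Algebra.Properties.Group +-group using (⁻¹-involutive)
      card′ : HasCardinality K (suc (suc (2 ℕ.* k)))
      card′ = ≡.subst (HasCardinality K) (ℕ.*-suc 2 k) card
      -1≉0 : - 1# ≉ 0#
      -1≉0 -1≈0 = 1≉0 (trans (sym (+-identityʳ 1#)) (trans (+-congˡ (sym -1≈0)) (-‿inverseʳ 1#)))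
      [-1]²≈1 : (- 1#) ^ 2 ≈ 1#
      [-1]²≈1 = trans (*-congˡ (*-identityʳ _)) (trans (-1*x≈-x (- 1#)) (⁻¹-involutive 1#))
      -1≈1 : - 1# ≈ 1#
      -1≈1 = begin
        - 1#                        ≈⟨ *-identityʳ _ ⟨
        - 1# * 1#                   ≈⟨ *-congˡ (trans (^-congˡ k [-1]²≈1) (1#^n≈1# k)) ⟨
        - 1# * ((- 1#) ^ 2) ^ k     ≈⟨ *-congˡ (^-assocʳ (- 1#) 2 k) ⟩
        (- 1#) ^ suc (2 ℕ.* k)      ≈⟨ fermat card′ (- 1#) -1≉0 ⟩
        1#                          ∎

  module SquareOrder (isField : IsField K) (j : ℕ)
                     (card : HasCardinality K ((2 ℕ.^ suc j) ℕ.^ 2)) where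
    open IsField isField using (1≉0; inverse)

    q : ℕ
    q = 2 ℕ.^ suc j

    open CharacteristicTwo
      (characteristic-two isField {2 ℕ.^ j ℕ.* (q ℕ.* 1)}
        (≡.subst (HasCardinality K) (ℕ.*-assoc 2 (2 ℕ.^ j) (q ℕ.* 1)) card))

    ^q-involutive : ∀ x → (x ^ q) ^ q ≈ x
    ^q-involutive x = begin
      (x ^ q) ^ q      ≈⟨ ^-assocʳ x q q ⟩
      x ^ (q ℕ.* q)    ≈⟨ ^-congʳ x (≡.cong (q ℕ.*_) (ℕ.*-identityʳ q)) ⟨
      x ^ (q ℕ.^ 2)    ≈⟨ ^-cardinality≈id isField card x ⟩
      x                ∎

    relTrace : Carrier → Carrier
    relTrace x = x + x ^ q

    relTrace-fixed : ∀ x → relTrace x ^ q ≈ relTrace x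
    relTrace-fixed x =
      trans (^2^-distrib-+ (suc j) x (x ^ q)) (trans (+-congˡ (^q-involutive x)) (+-comm _ _))

    x^q+x-polynomial : IsPolynomial q 1# (λ x → x ^ q + x)
    x^q+x-polynomial = +-polynomial-dominant (1<2^[1+j] j) (xⁿ-polynomial q) id-polynomial

    ∃-relTrace≉0 : ∃ λ ξ → relTrace ξ ≉ 0#
    ∃-relTrace≉0 with ∃-nonroot isField card x^q+x-polynomial 1≉0 (2^[1+j]<[2^[1+j]]² j)
    ... | ξ , ξ^q+ξ≉0 = ξ , λ relTraceξ≈0 → ξ^q+ξ≉0 (trans (+-comm _ _) relTraceξ≈0)

    ∃-relTrace≈1 : ∃ λ η₀ → relTrace η₀ ≈ 1#
    ∃-relTrace≈1 with ∃-relTrace≉0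
    ... | ξ , s≉0 with inverse (relTrace ξ) s≉0
    ...   | s⁻¹ , s⁻¹s≈1 = ξ * s⁻¹ , (begin
      ξ * s⁻¹ + (ξ * s⁻¹) ^ q      ≈⟨ +-congˡ (^-distrib-* ξ s⁻¹ q) ⟩
      ξ * s⁻¹ + ξ ^ q * s⁻¹ ^ q    ≈⟨ +-congˡ (*-congˡ s⁻¹-fixed) ⟩
      ξ * s⁻¹ + ξ ^ q * s⁻¹        ≈⟨ distribʳ s⁻¹ ξ (ξ ^ q) ⟨
      relTrace ξ * s⁻¹             ≈⟨ *-comm _ _ ⟩
      s⁻¹ * relTrace ξ             ≈⟨ s⁻¹s≈1 ⟩
      1#                           ∎)
      where
      s⁻¹-fixed : s⁻¹ ^ q ≈ s⁻¹
      s⁻¹-fixed = ^-fixed-inverse isField q s⁻¹s≈1 (relTrace-fixed ξ)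

    η₀ : Carrier
    η₀ = proj₁ ∃-relTrace≈1

    η : Carrier → Carrier
    η x = η₀ + relTrace x

    η-relTrace : ∀ x → relTrace (η x) ≈ 1#
    η-relTrace x = begin
      (η₀ + t) + (η₀ + t) ^ q      ≈⟨ +-congˡ (^2^-distrib-+ (suc j) η₀ t) ⟩
      (η₀ + t) + (η₀ ^ q + t ^ q)  ≈⟨ +-congˡ (+-congˡ (relTrace-fixed x)) ⟩
      (η₀ + t) + (η₀ ^ q + t)      ≈⟨ regroup η₀ (η₀ ^ q) t ⟩
      relTrace η₀ + (t + t)        ≈⟨ +-cong (proj₂ ∃-relTrace≈1) (x+x≈0 t) ⟩
      1# + 0#                      ≈⟨ +-identityʳ 1# ⟩
      1#                           ∎
      where
      t : Carrier
      t = relTrace x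
      regroup : ∀ a b t → (a + t) + (b + t) ≈ (a + b) + (t + t)
      regroup = solve 3 (λ a b t → (a :+ t) :+ (b :+ t) := (a :+ b) :+ (t :+ t)) refl

    η-polynomial : IsPolynomial q 1# η
    η-polynomial = IsPolynomial-resp (λ x → rearrange η₀ x (x ^ q))
      (+-polynomial-dominant (1<2^[1+j] j) (xⁿ-polynomial q)
        (horner η₀ (constant (λ _ → refl)) (λ x → +-congˡ (sym (*-identityʳ x)))))
      where
      rearrange : ∀ a x y → a + (x + y) ≈ y + (a + x)
      rearrange = solve 3 (λ a x y → a :+ (x :+ y) := y :+ (a :+ x)) refl

    u : Carrier → Carrier
    u x = ℘ (η x)

    u-≉0 : ∀ x → u x ≉ 0#
    u-≉0 x ux≈0 = 1≉0 (begin
      1#               ≈⟨ η-relTrace x ⟨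
      η x + η x ^ q    ≈⟨ +-congˡ (idempotent⇒^2^≈id (℘≈0⇒idempotent ux≈0) (suc j)) ⟩
      η x + η x        ≈⟨ x+x≈0 (η x) ⟩
      0#               ∎)

    u-fixed : ∀ x → u x ^ q ≈ u x
    u-fixed x = begin
      ℘ (η x) ^ q     ≈⟨ ℘-^2^ (suc j) (η x) ⟩
      ℘ (η x ^ q)     ≈⟨ ℘-cong (x+y≈z⇒y≈x+z (η-relTrace x)) ⟩
      ℘ (η x + 1#)    ≈⟨ ℘-+1 (η x) ⟩
      ℘ (η x)         ∎

    u-polynomial : IsPolynomial (2 ℕ.* q) 1# u
    u-polynomial = IsPolynomial-resp (λ x → +-comm _ _)
      (+-polynomial-dominant (ℕ.^-monoʳ-< 2 (ℕ.n<1+n 1) (ℕ.n<1+n (suc j)))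
        (leading-cong (1#^n≈1# 2) (^-polynomial 2 η-polynomial)) η-polynomial)

    u⁻¹ : Carrier → Carrier
    u⁻¹ x = proj₁ (inverse (u x) (u-≉0 x))

    u⁻¹-inverse : ∀ x → u⁻¹ x * u x ≈ 1#
    u⁻¹-inverse x = proj₂ (inverse (u x) (u-≉0 x))

    u⁻¹-fixed : ∀ x → u⁻¹ x ^ q ≈ u⁻¹ x
    u⁻¹-fixed x = ^-fixed-inverse isField q (u⁻¹-inverse x) (u-fixed x)

    clearedTrace-u-polynomial : ∀ c →
      IsPolynomial (mersenne j ℕ.* (2 ℕ.* q)) c (λ x → clearedTrace c (u x) j)
    clearedTrace-u-polynomial c =
      clearedTrace-polynomial c (ℕ.m^n>0 2 (suc (suc j))) u-polynomial j

    ∃-clearedTrace≉0 : ∀ {c} → c ≉ 0# → ∃ λ x → clearedTrace c (u x) j ≉ 0#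
    ∃-clearedTrace≉0 {c} c≉0 =
      ∃-nonroot isField card (clearedTrace-u-polynomial c) c≉0 (mersenne*2^[2+j]<[2^[1+j]]² j)

    ∃-trace≈1 : ∀ {c} → c ^ q ≈ c → c ≉ 0# → ∃ λ x → trace K (suc j) (c * u⁻¹ x) ≈ 1#
    ∃-trace≈1 {c} c-fixed c≉0 = conclude (∃-clearedTrace≉0 c≉0)
      where
      conclude : (∃ λ x → clearedTrace c (u x) j ≉ 0#) → ∃ λ x → trace K (suc j) (c * u⁻¹ x) ≈ 1#
      conclude (x , cleared≉0) =
        x , idempotent-≉0⇒≈1 isField (trace-idempotent (suc j) z z-fixed) T≉0
        where
        z : Carrier
        z = c * u⁻¹ x
        z-fixed : z ^ q ≈ z
        z-fixed = trans (^-distrib-* c (u⁻¹ x) q) (*-cong c-fixed (u⁻¹-fixed x))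
        T≉0 : trace K (suc j) z ≉ 0#
        T≉0 T≈0 = cleared≉0 (begin
          clearedTrace c (u x) j                ≈⟨ clearedTrace-spec c (u⁻¹-inverse x) j ⟨
          u x ^ (2 ℕ.^ j) * trace K (suc j) z   ≈⟨ *-congˡ T≈0 ⟩
          u x ^ (2 ℕ.^ j) * 0#                  ≈⟨ zeroʳ _ ⟩
          0#                                    ∎)

open Defs using (_^_)

lemma3p5 : ∀ {c ℓ} (K : CommutativeRing c ℓ) → IsField K →
    let open CommutativeRing K in
    (m : ℕ) → 2 ≤ m →
    HasCardinality K ((2 ℕ.^ m) ℕ.^ 2) →
    (a : Carrier) → _^_ K a (2 ℕ.^ m) ≈ a → ¬ (a ≈ 0#) →
    ∃ λ η → (η + _^_ K η (2 ℕ.^ m) ≈ 1#) ×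
      (∃ λ y → (y * (η + _^_ K η 2) ≈ 1#) × (trace K m (_^_ K a 2 * y) ≈ 1#))
lemma3p5 K isField (suc j) (s≤s _) card a a-fixed a≉0 =
  let x , trace≈1 = ∃-trace≈1 a²-fixed a²≉0 in
  η x , η-relTrace x , u⁻¹ x , u⁻¹-inverse x , trace≈1
  where
  open CommutativeRing K
  open SquareOrder K isField j card
  a²-fixed : _^_ K (_^_ K a 2) q ≈ _^_ K a 2
  a²-fixed = ^-fixed-^ K {a} {q} 2 a-fixed
  a²≉0 : _^_ K a 2 ≉ 0#
  a²≉0 = ^-≉0 K isField 2 a≉0
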